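{- Let $G$ be a finite group, $\alpha$ an involutory automorphism of $G$, $H$ a subgroup of $G$, and $g\in G$ with $\alpha(g)=g$. If $H$ is a perfect code of $GC(G,S,\alpha)$ for some generalized Cayley subset $S$ of $G$ induced by $\alpha$, then $g^{ -1}Sg$ is a generalized Cayley subset of $G$ induced by $\alpha$ and $g^{ -1}Hg$ is a perfect code of $GC(G,g^{ -1}Sg,\alpha)$.
   Context: $G$ is a finite group with identity $e$, and $\alpha$ is an involutory automorphism of $G$ ($\alpha\in\mathrm{Aut}(G)$, $\alpha^2=\mathrm{id}\neq\alpha$). Set $\omega_\alpha(G)=\{\alpha(x^{ -1})x\mid x\in G\}$. A subset $S\subseteq G$ is a generalized Cayley subset of $G$ induced by $\alpha$ if $S\cap\omega_\alpha(G)=\emptyset$ and $\alpha(S)=S^{ -1}$ (where $\alpha(A)=\{\alpha(a)\mid a\in A\}$, $A^{ -1}=\{a^{ -1}\mid a\in A\}$). The generalized Cayley graph $GC(G,S,\alpha)$ has vertex set $G$ and edge set $\{\{x,y\}\mid \alpha(x^{ -1})y\in S\}$. A subset $C$ of the vertex set of a graph is a perfect code if $C$ is independent and every vertex outside $C$ is adjacent to exactly one vertex of $C$. $g^{ -1}Ag=\{g^{ -1}ag\mid a\in A\}$. -}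

module Defs where

open import Level using (Level; _⊔_; suc)
open import Data.Nat using (ℕ)
open import Data.Fin using (Fin)
open import Data.Product using (Σ; ∃; ∃!; _×_; _,_)
open import Data.Sum using (_⊎_)
open import Relation.Nullary using (¬_)
open import Relation.Unary using (Pred)
open import Relation.Binary.PropositionalEquality using (_≡_)
open import Function.Bundles using (_↔_)
open import Function.Definitions using (Bijective)
open import Algebra.Structures using (IsGroup)

record FiniteGroup (c : Level) : Set (suc c) where
  infixl 7 _∙_
  infix  8 _⁻¹
  field
    Carrier : Set c
    _∙_     : Carrier → Carrier → Carrier
    e       : Carrier
    _⁻¹     : Carrier → Carrier
    isGroup : IsGroup _≡_ _∙_ e _⁻¹
    order   : ℕ
    enum    : Carrier ↔ Fin order

module _ {c : Level} (G : FiniteGroup c) where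
  open FiniteGroup G

  record IsInvolutoryAutomorphism (α : Carrier → Carrier) : Set c where
    field
      homo       : ∀ x y → α (x ∙ y) ≡ α x ∙ α y
      bijective  : Bijective _≡_ _≡_ α
      involutive : ∀ x → α (α x) ≡ x
      nonIdentity : ¬ (∀ x → α x ≡ x)

  record IsSubgroup {ℓ : Level} (H : Pred Carrier ℓ) : Set (c ⊔ ℓ) where
    field
      has-e   : H e
      closed∙ : ∀ {x y} → H x → H y → H (x ∙ y)
      closed⁻¹ : ∀ {x} → H x → H (x ⁻¹)

  ω : (Carrier → Carrier) → Pred Carrier c
  ω α y = ∃ λ x → α (x ⁻¹) ∙ x ≡ y

  image : {ℓ : Level} → (Carrier → Carrier) → Pred Carrier ℓ → Pred Carrier (c ⊔ ℓ)
  image α A y = ∃ λ a → A a × α a ≡ y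

  inverseSet : {ℓ : Level} → Pred Carrier ℓ → Pred Carrier (c ⊔ ℓ)
  inverseSet A y = ∃ λ a → A a × a ⁻¹ ≡ y

  conj : {ℓ : Level} → Carrier → Pred Carrier ℓ → Pred Carrier (c ⊔ ℓ)
  conj g A y = ∃ λ a → A a × (g ⁻¹ ∙ a) ∙ g ≡ y

  record IsGenCayleySubset {ℓ : Level} (α : Carrier → Carrier) (S : Pred Carrier ℓ) : Set (c ⊔ ℓ) where
    field
      disjoint : ∀ s → S s → ¬ ω α s
      image⊆inv : ∀ y → image α S y → inverseSet S y
      inv⊆image : ∀ y → inverseSet S y → image α S y

  -- edges of GC(G,S,α): {x,y} is an edge iff α(x⁻¹)y ∈ S
  -- (as an unordered pair: either orientation witnesses the edge)
  Adj : {ℓ : Level} → (Carrier → Carrier) → Pred Carrier ℓ → Carrier → Carrier → Set ℓ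
  Adj α S x y = S (α (x ⁻¹) ∙ y) ⊎ S (α (y ⁻¹) ∙ x)

  record IsPerfectCode {ℓ ℓ' : Level} (α : Carrier → Carrier) (S : Pred Carrier ℓ)
                       (C : Pred Carrier ℓ') : Set (c ⊔ ℓ ⊔ ℓ') where
    field
      independent : ∀ x y → C x → C y → ¬ Adj α S x y
      unique-neighbour : ∀ v → ¬ C v → ∃! _≡_ (λ u → C u × Adj α S v u)

{-# OPTIONS --safe #-}
-- Conjugation by an α-fixed element g is an automorphism of G commuting
-- with α.  Any such automorphism φ satisfies φ(α(x⁻¹)y) = α(φ(x)⁻¹)φ(y),
-- so it is a graph isomorphism GC(G,S,α) ≅ GC(G,φ(S),α) which also maps
-- ω_α(G) onto itself; hence it carries generalized Cayley subsets to
-- generalized Cayley subsets and perfect codes to perfect codes.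
module Submission where

open import Defs
open import Level using (Level)
open import Function.Base using (_∘_; id)
open import Data.Product using (_×_; _,_; ∃!)
open import Relation.Nullary using (¬_)
open import Data.Sum using (inj₁; inj₂)
open import Relation.Unary using (Pred)
open import Relation.Binary.PropositionalEquality
open import Algebra.Bundles using (Group)
open import Algebra.Structures using (IsGroup)
import Algebra.Properties.Group as GroupProperties
import Algebra.Properties.Monoid as MonoidProperties
import Algebra.Morphism.Definitions as MorphismDefinitions

module _ {c : Level} (G : FiniteGroup c) where
  open FiniteGroup G
  open IsGroup isGroup using (assoc; identityʳ; inverseʳ)
  open MorphismDefinitions Carrier Carrier _≡_ using (Homomorphic₁; Homomorphic₂)
  open ≡-Reasoning

  group : Group c c
  group = record { isGroup = isGroup }

  open GroupProperties group using (identityʳ-unique; inverseʳ-unique; ⁻¹-involutive)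
  open MonoidProperties (Group.monoid group) using (cancelˡ; cancelʳ)

  module _ {f : Carrier → Carrier} (∙-homo : Homomorphic₂ f _∙_ _∙_) where

    ∙-homo⇒ε-homo : f e ≡ e
    ∙-homo⇒ε-homo = identityʳ-unique (f e) (f e)
      (trans (sym (∙-homo e e)) (cong f (identityʳ e)))

    ∙-homo⇒⁻¹-homo : Homomorphic₁ f _⁻¹ _⁻¹
    ∙-homo⇒⁻¹-homo x = inverseʳ-unique (f x) (f (x ⁻¹))
      (trans (sym (∙-homo x (x ⁻¹))) (trans (cong f (inverseʳ x)) ∙-homo⇒ε-homo))

  -- conj G g A unfolds to image G (conjugate g) A.
  conjugate : Carrier → Carrier → Carrier
  conjugate g x = (g ⁻¹ ∙ x) ∙ g

  conjugate-∙-homo : ∀ g → Homomorphic₂ (conjugate g) _∙_ _∙_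
  conjugate-∙-homo g x y = sym (begin
    (g ⁻¹ ∙ x ∙ g) ∙ (g ⁻¹ ∙ y ∙ g)   ≡⟨ cong (g ⁻¹ ∙ x ∙ g ∙_) (assoc (g ⁻¹) y g) ⟩
    (g ⁻¹ ∙ x ∙ g) ∙ (g ⁻¹ ∙ (y ∙ g)) ≡⟨ sym (assoc _ (g ⁻¹) (y ∙ g)) ⟩
    (g ⁻¹ ∙ x ∙ g ∙ g ⁻¹) ∙ (y ∙ g)   ≡⟨ cong (_∙ (y ∙ g)) (cancelʳ (inverseʳ g) (g ⁻¹ ∙ x)) ⟩
    (g ⁻¹ ∙ x) ∙ (y ∙ g)              ≡⟨ sym (assoc (g ⁻¹ ∙ x) y g) ⟩
    g ⁻¹ ∙ x ∙ y ∙ g                  ≡⟨ cong (_∙ g) (assoc (g ⁻¹) x y) ⟩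
    g ⁻¹ ∙ (x ∙ y) ∙ g                ∎)

  conjugate-inverseˡ : ∀ g → conjugate (g ⁻¹) ∘ conjugate g ≗ id
  conjugate-inverseˡ g x = begin
    (g ⁻¹ ⁻¹ ∙ (g ⁻¹ ∙ x ∙ g)) ∙ g ⁻¹ ≡⟨ cong (λ h → (h ∙ (g ⁻¹ ∙ x ∙ g)) ∙ g ⁻¹) (⁻¹-involutive g) ⟩
    (g ∙ (g ⁻¹ ∙ x ∙ g)) ∙ g ⁻¹       ≡⟨ cong (_∙ g ⁻¹) (sym (assoc g (g ⁻¹ ∙ x) g)) ⟩
    (g ∙ (g ⁻¹ ∙ x) ∙ g) ∙ g ⁻¹       ≡⟨ cong (λ y → y ∙ g ∙ g ⁻¹) (cancelˡ (inverseʳ g) x) ⟩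
    x ∙ g ∙ g ⁻¹                      ≡⟨ cancelʳ (inverseʳ g) x ⟩
    x                                 ∎

  conjugate-inverseʳ : ∀ g → conjugate g ∘ conjugate (g ⁻¹) ≗ id
  conjugate-inverseʳ g = subst (λ h → conjugate h ∘ conjugate (g ⁻¹) ≗ id)
    (⁻¹-involutive g) (conjugate-inverseˡ (g ⁻¹))

  ∙-homo⇒conjugate-homo : ∀ {f} → Homomorphic₂ f _∙_ _∙_ →
                          ∀ g x → f (conjugate g x) ≡ conjugate (f g) (f x)
  ∙-homo⇒conjugate-homo {f} ∙-homo g x = begin
    f (g ⁻¹ ∙ x ∙ g)     ≡⟨ ∙-homo (g ⁻¹ ∙ x) g ⟩
    f (g ⁻¹ ∙ x) ∙ f g   ≡⟨ cong (_∙ f g) (∙-homo (g ⁻¹) x) ⟩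
    f (g ⁻¹) ∙ f x ∙ f g ≡⟨ cong (λ y → y ∙ f x ∙ f g) (∙-homo⇒⁻¹-homo ∙-homo g) ⟩
    f g ⁻¹ ∙ f x ∙ f g   ∎

  module CommutingAutomorphism {α φ φ⁻¹ : Carrier → Carrier}
           (α-homo : Homomorphic₂ α _∙_ _∙_) (φ-homo : Homomorphic₂ φ _∙_ _∙_)
           (φ-inverseˡ : φ⁻¹ ∘ φ ≗ id) (φ-inverseʳ : φ ∘ φ⁻¹ ≗ id)
           (φ-α-comm : φ ∘ α ≗ α ∘ φ) where

    φ-injective : ∀ {x y} → φ x ≡ φ y → x ≡ y
    φ-injective {x} {y} φx≡φy = begin
      x         ≡⟨ sym (φ-inverseˡ x) ⟩
      φ⁻¹ (φ x) ≡⟨ cong φ⁻¹ φx≡φy ⟩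
      φ⁻¹ (φ y) ≡⟨ φ-inverseˡ y ⟩
      y         ∎

    φ-twisted-homo : ∀ x y → φ (α (x ⁻¹) ∙ y) ≡ α (φ x ⁻¹) ∙ φ y
    φ-twisted-homo x y = begin
      φ (α (x ⁻¹) ∙ y)    ≡⟨ φ-homo (α (x ⁻¹)) y ⟩
      φ (α (x ⁻¹)) ∙ φ y  ≡⟨ cong (_∙ φ y) (φ-α-comm (x ⁻¹)) ⟩
      α (φ (x ⁻¹)) ∙ φ y  ≡⟨ cong (λ z → α z ∙ φ y) (∙-homo⇒⁻¹-homo φ-homo x) ⟩
      α (φ x ⁻¹) ∙ φ y    ∎

    ∈-image⁻ : ∀ {ℓ} {A : Pred Carrier ℓ} {x} → image G φ A (φ x) → A x
    ∈-image⁻ {A = A} (a , Aa , φa≡φx) = subst A (φ-injective φa≡φx) Aa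

    ω-image⁻ : ∀ {x} → ω G α (φ x) → ω G α x
    ω-image⁻ {x} (y , αy⁻¹y≡φx) = φ⁻¹ y , φ-injective (begin
      φ (α (φ⁻¹ y ⁻¹) ∙ φ⁻¹ y)     ≡⟨ φ-twisted-homo (φ⁻¹ y) (φ⁻¹ y) ⟩
      α (φ (φ⁻¹ y) ⁻¹) ∙ φ (φ⁻¹ y) ≡⟨ cong (λ z → α (z ⁻¹) ∙ z) (φ-inverseʳ y) ⟩
      α (y ⁻¹) ∙ y                 ≡⟨ αy⁻¹y≡φx ⟩
      φ x                          ∎)

    module _ {ℓ : Level} {S : Pred Carrier ℓ} where

      Adj-image⁺ : ∀ {x y} → Adj G α S x y → Adj G α (image G φ S) (φ x) (φ y)
      Adj-image⁺ {x} {y} (inj₁ s) = inj₁ (_ , s , φ-twisted-homo x y)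
      Adj-image⁺ {x} {y} (inj₂ s) = inj₂ (_ , s , φ-twisted-homo y x)

      Adj-image⁻ : ∀ {x y} → Adj G α (image G φ S) (φ x) (φ y) → Adj G α S x y
      Adj-image⁻ {x} {y} (inj₁ s) = inj₁ (∈-image⁻ (subst (image G φ S) (sym (φ-twisted-homo x y)) s))
      Adj-image⁻ {x} {y} (inj₂ s) = inj₂ (∈-image⁻ (subst (image G φ S) (sym (φ-twisted-homo y x)) s))

      image-isGenCayleySubset : IsGenCayleySubset G α S → IsGenCayleySubset G α (image G φ S)
      image-isGenCayleySubset S-gc = record
        { disjoint  = λ { _ (a , Sa , refl) ωφa → disjoint a Sa (ω-image⁻ ωφa) }
        ; image⊆inv = λ { _ (_ , (a , Sa , refl) , refl) → image⊆inv-φ a Sa }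
        ; inv⊆image = λ { _ (_ , (a , Sa , refl) , refl) → inv⊆image-φ a Sa }
        }
        where
        open IsGenCayleySubset S-gc

        image⊆inv-φ : ∀ a → S a → inverseSet G (image G φ S) (α (φ a))
        image⊆inv-φ a Sa with image⊆inv (α a) (a , Sa , refl)
        ... | s , Ss , s⁻¹≡αa = φ s , (s , Ss , refl) , (begin
          φ s ⁻¹    ≡⟨ sym (∙-homo⇒⁻¹-homo φ-homo s) ⟩
          φ (s ⁻¹)  ≡⟨ cong φ s⁻¹≡αa ⟩
          φ (α a)   ≡⟨ φ-α-comm a ⟩
          α (φ a)   ∎)

        inv⊆image-φ : ∀ a → S a → image G α (image G φ S) (φ a ⁻¹)
        inv⊆image-φ a Sa with inv⊆image (a ⁻¹) (a , Sa , refl)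
        ... | s , Ss , αs≡a⁻¹ = φ s , (s , Ss , refl) , (begin
          α (φ s)   ≡⟨ sym (φ-α-comm s) ⟩
          φ (α s)   ≡⟨ cong φ αs≡a⁻¹ ⟩
          φ (a ⁻¹)  ≡⟨ ∙-homo⇒⁻¹-homo φ-homo a ⟩
          φ a ⁻¹    ∎)

      image-isPerfectCode : ∀ {ℓ′} {C : Pred Carrier ℓ′} →
                            IsPerfectCode G α S C → IsPerfectCode G α (image G φ S) (image G φ C)
      image-isPerfectCode {C = C} C-pc = record
        { independent      = λ { _ _ (a , Ca , refl) (b , Cb , refl) adj →
                                 independent a b Ca Cb (Adj-image⁻ adj) }
        ; unique-neighbour = neighbour
        }
        where
        open IsPerfectCode C-pc

        neighbour : ∀ v → ¬ image G φ C v →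
                    ∃! _≡_ (λ u → image G φ C u × Adj G α (image G φ S) v u)
        neighbour v v∉φC with φ⁻¹ v | φ-inverseʳ v
        ... | w | refl with unique-neighbour w (λ Cw → v∉φC (w , Cw , refl))
        ... | u , (Cu , adj) , unique = φ u , ((u , Cu , refl) , Adj-image⁺ adj) ,
          λ { ((b , Cb , refl) , adj′) → cong φ (unique (Cb , Adj-image⁻ adj′)) }

proposition2p10 : {c ℓ ℓ' : Level} (G : FiniteGroup c)
    (α : FiniteGroup.Carrier G → FiniteGroup.Carrier G)
    → IsInvolutoryAutomorphism G α
    → (H : Pred (FiniteGroup.Carrier G) ℓ') → IsSubgroup G H
    → (g : FiniteGroup.Carrier G) → α g ≡ g
    → (S : Pred (FiniteGroup.Carrier G) ℓ) → IsGenCayleySubset G α S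
    → IsPerfectCode G α S H
    → IsGenCayleySubset G α (conj G g S) × IsPerfectCode G α (conj G g S) (conj G g H)
proposition2p10 G α α-inv H _ g αg≡g S S-gc H-pc =
  image-isGenCayleySubset S-gc , image-isPerfectCode H-pc
  where
  open IsInvolutoryAutomorphism α-inv using () renaming (homo to α-homo)

  conjugate-α-comm : conjugate G g ∘ α ≗ α ∘ conjugate G g
  conjugate-α-comm x = sym (begin
    α (conjugate G g x)       ≡⟨ ∙-homo⇒conjugate-homo G α-homo g x ⟩
    conjugate G (α g) (α x)   ≡⟨ cong (λ h → conjugate G h (α x)) αg≡g ⟩
    conjugate G g (α x)       ∎)
    where open ≡-Reasoning

  open CommutingAutomorphism G α-homo (conjugate-∙-homo G g)
    (conjugate-inverseˡ G g) (conjugate-inverseʳ G g) conjugate-α-comm
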